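{- Let $G_1=(V_1,E_1,\sigma_1,\mu_1)$ and $G_2=(V_2,E_2,\sigma_2,\mu_2)$ be balanced signed graphs (each equipped with a marking function). Then the corona product $G_1\circ G_2$ is unbalanced if and only if $G_2$ contains an edge of one of the following types: (i) a positive edge joining two oppositely marked nodes; (ii) a negative edge joining two positively marked nodes; (iii) a negative edge joining two negatively marked nodes.
   Context: A signed graph is $G=(V,E,\sigma,\mu)$ where $(V,E)$ is a simple graph, $\sigma:E\to\{+,-\}$ is the signature (edge signs), and $\mu:V\to\{+,-\}$ is a marking function determined by $\sigma$; the paper considers two markings: the canonical marking $\mu(v)=\prod_{e\ni v}\sigma(e)$ (product of the signs of the edges incident to $v$), and the plurality marking $\mu(v)=+$ if $d^+(v)\ge d^-(v)$ and $\mu(v)=-$ otherwise, where $d^\pm(v)$ is the number of positive/negative edges at $v$. A signed graph is balanced if every cycle contains an even number of negative edges (equivalently, per the paper's convention, all its cycles are balanced); otherwise unbalanced. Corona product: if $G_1$ has $n$ nodes $u_1,\dots,u_n$, then $G_1\circ G_2$ is obtained by taking one copy of $G_1$ and $n$ copies of $G_2$ (with their edge signs) and joining $u_i$ to every node of the $i$-th copy of $G_2$, the new edge between $u_i$ and the copy of $v\in V_2$ receiving the sign $\mu_1(u_i)\mu_2(v)$ (with $+\cdot+=-\cdot-=+$, $+\cdot-=-$). -}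

module Defs where

open import Data.Nat using (ℕ; zero; suc; _+_; _*_; _≤_)
open import Data.Bool using (Bool; true; false; if_then_else_)
open import Data.Maybe using (Maybe; just; nothing)
open import Data.Fin using (Fin; splitAt; remQuot; _≟_)
open import Data.List using (List; []; _∷_; _++_; [_]; length; foldr; map; allFin)
open import Data.Nat.ListAction using (sum)
open import Data.List.Relation.Unary.All using (All)
open import Data.List.Relation.Unary.Unique.Propositional using (Unique)
open import Data.Product using (_×_; _,_; ∃; ∃-syntax)
open import Data.Sum using (_⊎_; inj₁; inj₂)
open import Relation.Nullary using (¬_; does)
open import Relation.Binary.PropositionalEquality using (_≡_; _≢_)

data Sign : Set where
  pos neg : Sign

_·_ : Sign → Sign → Sign
pos · s = s
neg · pos = neg
neg · neg = pos

-- Signed adjacency on the node set Fin n: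
-- E i j ≡ nothing   : no edge between i and j
-- E i j ≡ just s    : an edge between i and j with sign s

SAdj : ℕ → Set
SAdj n = Fin n → Fin n → Maybe Sign

record SignedGraph (n : ℕ) : Set where
  field
    E      : SAdj n
    E-sym  : ∀ i j → E i j ≡ E j i
    E-loop : ∀ i → E i i ≡ nothing
open SignedGraph public

signOf : Maybe Sign → Sign
signOf nothing  = pos
signOf (just s) = s

pairs : {A : Set} → List A → List (A × A)
pairs []            = []
pairs (x ∷ [])      = []
pairs (x ∷ y ∷ xs)  = (x , y) ∷ pairs (y ∷ xs)

-- the edges of the closed walk v₀ v₁ … v_{k-1} v₀
cycleEdges : {A : Set} → List A → List (A × A)
cycleEdges []       = []
cycleEdges (x ∷ xs) = pairs (x ∷ xs ++ [ x ])

IsEdge : ∀ {n} → SAdj n → Fin n → Fin n → Set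
IsEdge E a b = ∃[ s ] (E a b ≡ just s)

IsCycle : ∀ {n} → SAdj n → List (Fin n) → Set
IsCycle E vs =
  (3 ≤ length vs) × Unique vs ×
  All (λ { (a , b) → IsEdge E a b }) (cycleEdges vs)

cycleSign : ∀ {n} → SAdj n → List (Fin n) → Sign
cycleSign E vs = foldr (λ { (a , b) s → signOf (E a b) · s }) pos (cycleEdges vs)

Balanced : ∀ {n} → SAdj n → Set
Balanced E = ∀ vs → IsCycle E vs → cycleSign E vs ≡ pos

canonical : ∀ {n} → SAdj n → Fin n → Sign
canonical {n} E v = foldr (λ j s → signOf (E v j) · s) pos (allFin n)

isPos isNeg : Maybe Sign → ℕ
isPos (just pos) = 1
isPos _          = 0
isNeg (just neg) = 1
isNeg _          = 0

deg⁺ deg⁻ : ∀ {n} → SAdj n → Fin n → ℕ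
deg⁺ {n} E v = sum (map (λ j → isPos (E v j)) (allFin n))
deg⁻ {n} E v = sum (map (λ j → isNeg (E v j)) (allFin n))

plurality : ∀ {n} → SAdj n → Fin n → Sign
plurality E v = if does (deg⁻ E v Data.Nat.≤? deg⁺ E v) then pos else neg
  where open import Data.Nat using (_≤?_)

data MarkingScheme : Set where
  canonicalM pluralityM : MarkingScheme

marking : MarkingScheme → ∀ {n} → SAdj n → Fin n → Sign
marking canonicalM E = canonical E
marking pluralityM E = plurality E

-- Node set Fin (n₁ + n₁ * n₂): the first n₁ nodes are the copy of G₁,
-- a node q of the second block with remQuot {n₁} n₂ q = (i , v) is the copy
-- of v ∈ V₂ in the i-th copy of G₂ (attached to u_i).

corona : ∀ {n₁ n₂} → SAdj n₁ → (Fin n₁ → Sign) → SAdj n₂ → (Fin n₂ → Sign)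
       → SAdj (n₁ + n₁ * n₂)
corona {n₁} {n₂} E₁ μ₁ E₂ μ₂ x y with splitAt n₁ x | splitAt n₁ y
... | inj₁ a | inj₁ b = E₁ a b
... | inj₁ a | inj₂ q with remQuot {n₁} n₂ q
...   | (i , v) = if does (a ≟ i) then just (μ₁ a · μ₂ v) else nothing
corona {n₁} {n₂} E₁ μ₁ E₂ μ₂ x y | inj₂ p | inj₁ a with remQuot {n₁} n₂ p
...   | (i , v) = if does (a ≟ i) then just (μ₁ a · μ₂ v) else nothing
corona {n₁} {n₂} E₁ μ₁ E₂ μ₂ x y | inj₂ p | inj₂ q with remQuot {n₁} n₂ p | remQuot {n₁} n₂ q
...   | (i , v) | (j , w) = if does (i ≟ j) then E₂ v w else nothing

HasSpecialEdge : ∀ {n} → SAdj n → (Fin n → Sign) → Set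
HasSpecialEdge {n} E μ = ∃[ v ] ∃[ w ]
  (  (E v w ≡ just pos × μ v ≢ μ w)
  ⊎ (E v w ≡ just neg × μ v ≡ pos × μ w ≡ pos)
  ⊎ (E v w ≡ just neg × μ v ≡ neg × μ w ≡ neg))

module Submission where

-- Write C = G₁ ∘ G₂ for the corona product, whose node u_i is joined to every
-- node (i , v) of the i-th copy of G₂.  Call an edge v w of G₂ with sign s
-- frustrated when s ≠ μ₂(v) μ₂(w); the three edge types of the theorem are
-- exactly the frustrated edges (special⇒frustrated, frustrated⇒special).
--
-- (⇐) A frustrated edge v w gives the triangle u_i, (i , v), (i , w) in C whose
--     sign is μ₂(v) μ₂(w) s = − (the two hub edges contribute the same factor
--     μ₁(u_i) twice), so C is unbalanced.
-- (⇒) Without frustrated edges, every edge of C carries the sign of its image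
--     under the projection (i , v) ↦ u_i, switched at both ends by
--     τ(u_i) = +, τ(i , v) = μ₁(u_i) μ₂(v).  Hence a cycle of C has the sign
--     of its image, a closed walk of G₁ that may repeat nodes and stay put
--     at a node.  In a balanced graph every such closed walk is positive:
--     cut it at a repeated node into two shorter closed walks, and the
--     remaining repetition-free walks are cycles or walks of length ≤ 2.

open import Defs
open import Data.Nat using (ℕ; _+_; _*_; _≤_; _<_; s≤s; z≤n)
open import Data.Nat.Properties using (≤-refl; ≤-trans; <-trans; n≤1+n)
open import Data.Nat.Induction using (<-wellFounded)
open import Induction.WellFounded using (Acc; acc)
open import Data.Maybe using (just)
open import Data.Maybe.Properties using (just-injective; ≡-dec)
open import Data.Fin using (Fin; _≟_; splitAt; remQuot; quotRem; combine; fromℕ<; _↑ˡ_; _↑ʳ_)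
open import Data.Fin.Properties
  using (splitAt-↑ˡ; splitAt-↑ʳ; remQuot-combine; ↑ʳ-injective; combine-injectiveʳ; any?)
open import Data.List using (List; []; _∷_; _++_; [_]; length; map; foldr)
open import Data.List.Properties using (++-assoc; map-++)
open import Data.List.Membership.Propositional.Properties using (∈-∃++)
open import Data.List.Relation.Unary.All using (All; []; _∷_; zipWith)
open import Data.List.Relation.Unary.All.Properties using (++⁺; ++⁻ˡ; ++⁻ʳ; ¬Any⇒All¬)
open import Data.List.Relation.Unary.AllPairs using ([]; _∷_)
open import Data.List.Relation.Unary.Unique.Propositional using (Unique)
open import Data.Product using (_×_; _,_; ∃-syntax; proj₁; proj₂; swap)
open import Data.Sum using (_⊎_; inj₁; inj₂) renaming ([_,_]′ to either)
open import Data.Empty using (⊥-elim)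
open import Relation.Nullary using (¬_; Dec; yes; no; contradiction)
open import Relation.Nullary.Decidable using (dec-true)
open import Relation.Binary.PropositionalEquality hiding ([_])
open ≡-Reasoning

·-identityʳ : ∀ s → s · pos ≡ s
·-identityʳ pos = refl
·-identityʳ neg = refl

·-comm : ∀ a b → a · b ≡ b · a
·-comm pos pos = refl
·-comm pos neg = refl
·-comm neg pos = refl
·-comm neg neg = refl

·-assoc : ∀ a b c → (a · b) · c ≡ a · (b · c)
·-assoc pos b c = refl
·-assoc neg pos c = refl
·-assoc neg neg pos = refl
·-assoc neg neg neg = refl

·-inverse : ∀ s → s · s ≡ pos
·-inverse pos = refl
·-inverse neg = refl

·-cancelˡ : ∀ a b → a · (a · b) ≡ b
·-cancelˡ a b = trans (sym (·-assoc a a b)) (cong (_· b) (·-inverse a))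

·-fixes⇒pos : ∀ a s → a · s ≡ a → s ≡ pos
·-fixes⇒pos a s eq = begin
  s              ≡⟨ sym (·-cancelˡ a s) ⟩
  a · (a · s)    ≡⟨ cong (a ·_) eq ⟩
  a · a          ≡⟨ ·-inverse a ⟩
  pos            ∎

·-switch : ∀ t a b → (t · a) · (t · b) ≡ a · b
·-switch pos a b = refl
·-switch neg pos b = ·-cancelˡ neg b
·-switch neg neg pos = refl
·-switch neg neg neg = refl

sign-dichotomy : ∀ s t → s ≡ t ⊎ s ≡ neg · t
sign-dichotomy pos pos = inj₁ refl
sign-dichotomy pos neg = inj₂ refl
sign-dichotomy neg pos = inj₂ refl
sign-dichotomy neg neg = inj₁ refl

_≟ˢ_ : (a b : Sign) → Dec (a ≡ b)
pos ≟ˢ pos = yes refl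
pos ≟ˢ neg = no (λ ())
neg ≟ˢ pos = no (λ ())
neg ≟ˢ neg = yes refl

-- A walk is described by its list of steps (a , b).  A step is lazy when
-- it follows an edge or stays at its node; its sign is that of the edge,
-- and pos for a stay (there are no loops).

walkSign : ∀ {n} → SAdj n → List (Fin n × Fin n) → Sign
walkSign E []              = pos
walkSign E ((a , b) ∷ st) = signOf (E a b) · walkSign E st

walkSign-++ : ∀ {n} (E : SAdj n) st st′ → walkSign E (st ++ st′) ≡ walkSign E st · walkSign E st′
walkSign-++ E [] st′ = refl
walkSign-++ E ((a , b) ∷ st) st′ =
  trans (cong (signOf (E a b) ·_) (walkSign-++ E st st′))
        (sym (·-assoc (signOf (E a b)) (walkSign E st) (walkSign E st′)))

cycleSign≡walkSign : ∀ {n} (E : SAdj n) vs → cycleSign E vs ≡ walkSign E (cycleEdges vs)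
cycleSign≡walkSign E vs = go (cycleEdges vs)
  where
    go : ∀ st → foldr (λ { (a , b) s → signOf (E a b) · s }) pos st ≡ walkSign E st
    go []            = refl
    go ((a , b) ∷ st) = cong (signOf (E a b) ·_) (go st)

EdgeStep : ∀ {n} → SAdj n → Fin n × Fin n → Set
EdgeStep E (a , b) = IsEdge E a b

LazyStep : ∀ {n} → SAdj n → Fin n × Fin n → Set
LazyStep E (a , b) = IsEdge E a b ⊎ a ≡ b

Distinct : ∀ {n} → Fin n × Fin n → Set
Distinct (a , b) = a ≢ b

around : {A : Set} → A → List A → List (A × A)
around h body = pairs (h ∷ body ++ [ h ])

pairs-join : {A : Set} (xs : List A) (m : A) (ys : List A) →
  pairs (xs ++ m ∷ ys) ≡ pairs (xs ++ [ m ]) ++ pairs (m ∷ ys)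
pairs-join []           m ys = refl
pairs-join (x ∷ [])     m ys = refl
pairs-join (x ∷ y ∷ xs) m ys = cong ((x , y) ∷_) (pairs-join (y ∷ xs) m ys)

snoc-assoc : {A : Set} (xs : List A) (y : A) (ys : List A) (z : A) →
  (xs ++ y ∷ ys) ++ [ z ] ≡ xs ++ y ∷ ys ++ [ z ]
snoc-assoc xs y ys z = ++-assoc xs (y ∷ ys) [ z ]

-- a closed walk through h that returns to h midway is two closed walks at h
-- (written with an empty prefix, the form splice-pos expects)
around-revisit : {A : Set} (h : A) (bs cs : List A) →
  around h (bs ++ h ∷ cs) ≡ [] ++ around h bs ++ around h cs
around-revisit h bs cs = trans (cong (λ l → pairs (h ∷ l)) (snoc-assoc bs h cs h))
                               (pairs-join (h ∷ bs) h (cs ++ [ h ]))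

around-excise : {A : Set} (h : A) (as : List A) (m : A) (bs cs : List A) →
  around h (as ++ m ∷ bs ++ m ∷ cs)
    ≡ pairs (h ∷ as ++ [ m ]) ++ around m bs ++ pairs (m ∷ cs ++ [ h ])
around-excise h as m bs cs = begin
  pairs (h ∷ (as ++ m ∷ bs ++ m ∷ cs) ++ [ h ])
    ≡⟨ cong (λ l → pairs (h ∷ l)) (snoc-assoc as m (bs ++ m ∷ cs) h) ⟩
  pairs ((h ∷ as) ++ m ∷ (bs ++ m ∷ cs) ++ [ h ])
    ≡⟨ cong (λ l → pairs ((h ∷ as) ++ m ∷ l)) (snoc-assoc bs m cs h) ⟩
  pairs ((h ∷ as) ++ m ∷ bs ++ m ∷ cs ++ [ h ])
    ≡⟨ pairs-join (h ∷ as) m (bs ++ m ∷ cs ++ [ h ]) ⟩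
  pairs (h ∷ as ++ [ m ]) ++ pairs ((m ∷ bs) ++ m ∷ cs ++ [ h ])
    ≡⟨ cong (pairs (h ∷ as ++ [ m ]) ++_) (pairs-join (m ∷ bs) m (cs ++ [ h ])) ⟩
  pairs (h ∷ as ++ [ m ]) ++ around m bs ++ pairs (m ∷ cs ++ [ h ]) ∎

around-excised : {A : Set} (h : A) (as : List A) (m : A) (cs : List A) →
  around h (as ++ m ∷ cs) ≡ pairs (h ∷ as ++ [ m ]) ++ pairs (m ∷ cs ++ [ h ])
around-excised h as m cs = trans (cong (λ l → pairs (h ∷ l)) (snoc-assoc as m cs h))
                                 (pairs-join (h ∷ as) m (cs ++ [ h ]))

splice-pos : ∀ {n} (E : SAdj n) (S : Fin n × Fin n → Set) st rest P L Q →
  st ≡ P ++ L ++ Q → rest ≡ P ++ Q → All S st →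
  (All S L → walkSign E L ≡ pos) → (All S rest → walkSign E rest ≡ pos) →
  walkSign E st ≡ pos
splice-pos E S st rest P L Q refl refl all L-pos rest-pos = begin
  walkSign E (P ++ L ++ Q)                        ≡⟨ walkSign-++ E P (L ++ Q) ⟩
  walkSign E P · walkSign E (L ++ Q)              ≡⟨ cong (walkSign E P ·_) (walkSign-++ E L Q) ⟩
  walkSign E P · (walkSign E L · walkSign E Q)
    ≡⟨ cong (λ s → walkSign E P · (s · walkSign E Q)) (L-pos allL) ⟩
  walkSign E P · walkSign E Q                     ≡⟨ sym (walkSign-++ E P Q) ⟩
  walkSign E (P ++ Q)                             ≡⟨ rest-pos (++⁺ allP allQ) ⟩
  pos                                             ∎
  where
    allP : All S P
    allP = ++⁻ˡ P all
    allL : All S L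
    allL = ++⁻ˡ L (++⁻ʳ P all)
    allQ : All S Q
    allQ = ++⁻ʳ L (++⁻ʳ P all)

length-<ˡ : {A : Set} (xs : List A) (y : A) (ys : List A) → length xs < length (xs ++ y ∷ ys)
length-<ˡ []       y ys = s≤s z≤n
length-<ˡ (x ∷ xs) y ys = s≤s (length-<ˡ xs y ys)

length-<ʳ : {A : Set} (xs : List A) (y : A) (ys : List A) → length ys < length (xs ++ y ∷ ys)
length-<ʳ []       y ys = ≤-refl
length-<ʳ (x ∷ xs) y ys = ≤-trans (length-<ʳ xs y ys) (n≤1+n _)

length-excise : {A : Set} (as : List A) (m : A) (bs cs : List A) →
  length (as ++ m ∷ cs) < length (as ++ m ∷ bs ++ m ∷ cs)
length-excise []       m bs cs = s≤s (length-<ʳ bs m cs)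
length-excise (a ∷ as) m bs cs = s≤s (length-excise as m bs cs)

data Shape {n} (h : Fin n) : List (Fin n) → Set where
  revisit   : ∀ bs cs → Shape h (bs ++ h ∷ cs)
  innerLoop : ∀ as m bs cs → Shape h (as ++ m ∷ bs ++ m ∷ cs)
  simple    : ∀ {body} → Unique (h ∷ body) → Shape h body

module _ {n : ℕ} where
  open import Data.List.Membership.DecPropositional (_≟_ {n}) using (_∈?_)

  shape : (h : Fin n) (body : List (Fin n)) → Shape h body
  shape h [] = simple ([] ∷ [])
  shape h (x ∷ xs) with h ≟ x | shape h xs
  ... | yes refl | _                    = revisit [] xs
  ... | no _     | revisit bs cs        = revisit (x ∷ bs) cs
  ... | no _     | innerLoop as m bs cs = innerLoop (x ∷ as) m bs cs
  ... | no h≢x   | simple (h∉xs ∷ xs-unique) with x ∈? xs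
  ...   | no x∉xs = simple ((h≢x ∷ h∉xs) ∷ ¬Any⇒All¬ xs x∉xs ∷ xs-unique)
  ...   | yes x∈xs with ∈-∃++ x∈xs
  ...     | bs , cs , refl = innerLoop [] x bs cs

steps-distinct : ∀ {n} (h x : Fin n) xs → All (h ≢_) (x ∷ xs) → Unique (x ∷ xs) →
  All Distinct (pairs (x ∷ xs ++ [ h ]))
steps-distinct h x []       (h≢x ∷ []) _                  = (λ x≡h → h≢x (sym x≡h)) ∷ []
steps-distinct h x (y ∷ ys) (_ ∷ h∉)   ((x≢y ∷ _) ∷ uniq) = x≢y ∷ steps-distinct h y ys h∉ uniq

around-distinct : ∀ {n} (h b : Fin n) r → Unique (h ∷ b ∷ r) → All Distinct (around h (b ∷ r))
around-distinct h b r (h∉@(h≢b ∷ _) ∷ uniq) = h≢b ∷ steps-distinct h b r h∉ uniq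

lazy⇒edges : ∀ {n} (E : SAdj n) {st} → All (LazyStep E) st → All Distinct st → All (EdgeStep E) st
lazy⇒edges E lazy distinct = zipWith step (lazy , distinct)
  where
    step : ∀ {ab} → LazyStep E ab × Distinct ab → EdgeStep E ab
    step (inj₁ edge , _)  = edge
    step (inj₂ a≡b , a≢b) = ⊥-elim (a≢b a≡b)

module ClosedWalks {n} (G : SignedGraph n) (balanced : Balanced (E G)) where

  -- walks without repeated nodes: a stay, an edge traversed back and forth,
  -- or a cycle
  simple-pos : ∀ h body → Unique (h ∷ body) → All (LazyStep (E G)) (around h body) →
    walkSign (E G) (around h body) ≡ pos
  simple-pos h []          _    _    rewrite E-loop G h = refl
  simple-pos h (b ∷ [])    _    _    rewrite E-sym G b h =
    trans (cong (signOf (E G h b) ·_) (·-identityʳ _)) (·-inverse (signOf (E G h b)))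
  simple-pos h (b ∷ c ∷ r) uniq lazy =
    trans (sym (cycleSign≡walkSign (E G) (h ∷ b ∷ c ∷ r)))
          (balanced (h ∷ b ∷ c ∷ r)
            (s≤s (s≤s (s≤s z≤n)) , uniq , lazy⇒edges (E G) lazy (around-distinct h b (c ∷ r) uniq)))

  -- well-founded induction on the length of the body: a closed walk that
  -- revisits a node is cut there into two shorter closed walks
  closedWalk-pos : ∀ h body → All (LazyStep (E G)) (around h body) →
    walkSign (E G) (around h body) ≡ pos
  closedWalk-pos h body = go h body (<-wellFounded (length body))
    where
      go : ∀ h body → Acc _<_ (length body) → All (LazyStep (E G)) (around h body) →
        walkSign (E G) (around h body) ≡ pos
      go h body (acc rec) lazy with shape h body
      ... | revisit bs cs =
        splice-pos (E G) (LazyStep (E G)) _ _ [] (around h bs) (around h cs)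
          (around-revisit h bs cs) refl lazy
          (go h bs (rec (length-<ˡ bs h cs))) (go h cs (rec (length-<ʳ bs h cs)))
      ... | innerLoop as m bs cs =
        splice-pos (E G) (LazyStep (E G)) _ _ (pairs (h ∷ as ++ [ m ])) (around m bs)
          (pairs (m ∷ cs ++ [ h ])) (around-excise h as m bs cs) (around-excised h as m cs) lazy
          (go m bs (rec (<-trans (length-<ˡ bs m cs) (length-<ʳ as m (bs ++ m ∷ cs)))))
          (go h (as ++ m ∷ cs) (rec (length-excise as m bs cs)))
      ... | simple uniq = simple-pos h body uniq lazy

-- Balance of D then transfers to C.
SwitchingMap : ∀ {n k} → SAdj n → SignedGraph k → (Fin n → Fin k) → (Fin n → Sign) → Set
SwitchingMap C D g τ = ∀ x y s → C x y ≡ just s →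
  LazyStep (E D) (g x , g y) × s ≡ τ x · (signOf (E D (g x) (g y)) · τ y)

lastOf : {A : Set} → A → List A → A
lastOf x []       = x
lastOf x (y ∷ ys) = lastOf y ys

lastOf-snoc : {A : Set} (x : A) (xs : List A) (y : A) → lastOf x (xs ++ [ y ]) ≡ y
lastOf-snoc x []       y = refl
lastOf-snoc x (z ∷ xs) y = lastOf-snoc z xs y

module Switching {n k} (C : SAdj n) (D : SignedGraph k) (g : Fin n → Fin k) (τ : Fin n → Sign)
                 (switching : SwitchingMap C D g τ) where

  image-lazy : ∀ xs → All (EdgeStep C) (pairs xs) → All (LazyStep (E D)) (pairs (map g xs))
  image-lazy []           _                = []
  image-lazy (x ∷ [])     _                = []
  image-lazy (x ∷ y ∷ xs) ((s , e) ∷ rest) = proj₁ (switching x y s e) ∷ image-lazy (y ∷ xs) rest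

  -- along a walk the switchings at the inner nodes cancel, leaving those at
  -- its two ends
  telescope : ∀ x xs → All (EdgeStep C) (pairs (x ∷ xs)) →
    τ x · walkSign C (pairs (x ∷ xs)) ≡ walkSign (E D) (pairs (map g (x ∷ xs))) · τ (lastOf x xs)
  telescope x []       _                = ·-comm (τ x) pos
  telescope x (y ∷ xs) ((s , e) ∷ rest) = begin
    τ x · (signOf (C x y) · W)       ≡⟨ cong (λ u → τ x · (signOf u · W)) e ⟩
    τ x · (s · W)                    ≡⟨ cong (λ u → τ x · (u · W)) (proj₂ (switching x y s e)) ⟩
    τ x · ((τ x · (t · τ y)) · W)    ≡⟨ cong (τ x ·_) (·-assoc (τ x) (t · τ y) W) ⟩
    τ x · (τ x · ((t · τ y) · W))    ≡⟨ ·-cancelˡ (τ x) ((t · τ y) · W) ⟩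
    (t · τ y) · W                    ≡⟨ ·-assoc t (τ y) W ⟩
    t · (τ y · W)                    ≡⟨ cong (t ·_) (telescope y xs rest) ⟩
    t · (W′ · τ (lastOf y xs))       ≡⟨ sym (·-assoc t W′ (τ (lastOf y xs))) ⟩
    (t · W′) · τ (lastOf y xs)       ∎
    where
      W  = walkSign C (pairs (y ∷ xs))
      W′ = walkSign (E D) (pairs (map g (y ∷ xs)))
      t  = signOf (E D (g x) (g y))

  map-around : ∀ x xs → pairs (map g (x ∷ xs ++ [ x ])) ≡ around (g x) (map g xs)
  map-around x xs = cong (λ l → pairs (g x ∷ l)) (map-++ g xs [ x ])

  -- a cycle of C has the sign of its image, a closed lazy walk of D
  reflects-balance : Balanced (E D) → Balanced C
  reflects-balance balanced []       (() , _)
  reflects-balance balanced (x ∷ xs) (_ , _ , edges) = ·-fixes⇒pos (τ x) (cycleSign C (x ∷ xs)) (begin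
    τ x · cycleSign C (x ∷ xs)
      ≡⟨ cong (τ x ·_) (cycleSign≡walkSign C (x ∷ xs)) ⟩
    τ x · walkSign C (around x xs)
      ≡⟨ telescope x (xs ++ [ x ]) edges ⟩
    walkSign (E D) (pairs (map g (x ∷ xs ++ [ x ]))) · τ (lastOf x (xs ++ [ x ]))
      ≡⟨ cong₂ _·_ (cong (walkSign (E D)) (map-around x xs)) (cong τ (lastOf-snoc x xs x)) ⟩
    walkSign (E D) (around (g x) (map g xs)) · τ x
      ≡⟨ cong (_· τ x) (closedWalk-pos (g x) (map g xs) image) ⟩
    τ x ∎)
    where
      open ClosedWalks D balanced
      image : All (LazyStep (E D)) (around (g x) (map g xs))
      image = subst (All (LazyStep (E D))) (map-around x xs) (image-lazy (x ∷ xs ++ [ x ]) edges)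

Consistent : ∀ {n} → SAdj n → (Fin n → Sign) → Set
Consistent E μ = ∀ v w s → E v w ≡ just s → s ≡ μ v · μ w

Frustrated : ∀ {n} → SAdj n → (Fin n → Sign) → Set
Frustrated E μ = ∃[ v ] ∃[ w ] E v w ≡ just (neg · (μ v · μ w))

frustrated-or-consistent : ∀ {n} (E : SAdj n) μ → Frustrated E μ ⊎ Consistent E μ
frustrated-or-consistent E μ
  with any? (λ v → any? (λ w → ≡-dec _≟ˢ_ (E v w) (just (neg · (μ v · μ w)))))
... | yes frustrated = inj₁ frustrated
... | no none        = inj₂ consistent
  where
    consistent : Consistent E μ
    consistent v w s e with sign-dichotomy s (μ v · μ w)
    ... | inj₁ agrees   = agrees
    ... | inj₂ opposite = ⊥-elim (none (v , w , trans e (cong just opposite)))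

pos≢neg : pos ≢ neg
pos≢neg ()

opposite-markings : ∀ a b → a ≢ b → neg · (a · b) ≡ pos
opposite-markings pos pos a≢b = ⊥-elim (a≢b refl)
opposite-markings pos neg _   = refl
opposite-markings neg pos _   = refl
opposite-markings neg neg a≢b = ⊥-elim (a≢b refl)

special⇒frustrated : ∀ {n} (E : SAdj n) μ → HasSpecialEdge E μ → Frustrated E μ
special⇒frustrated E μ (v , w , inj₁ (e , μv≢μw)) =
  v , w , trans e (cong just (sym (opposite-markings (μ v) (μ w) μv≢μw)))
special⇒frustrated E μ (v , w , inj₂ (inj₁ (e , μv≡pos , μw≡pos))) =
  v , w , trans e (cong just (sym (cong₂ (λ a b → neg · (a · b)) μv≡pos μw≡pos)))
special⇒frustrated E μ (v , w , inj₂ (inj₂ (e , μv≡neg , μw≡neg))) =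
  v , w , trans e (cong just (sym (cong₂ (λ a b → neg · (a · b)) μv≡neg μw≡neg)))

frustrated⇒special : ∀ {n} (E : SAdj n) μ → Frustrated E μ → HasSpecialEdge E μ
frustrated⇒special E μ (v , w , e) with μ v in μv | μ w in μw
... | pos | pos = v , w , inj₂ (inj₁ (e , μv , μw))
... | pos | neg = v , w , inj₁ (e , λ μv≡μw → pos≢neg (trans (sym μv) (trans μv≡μw μw)))
... | neg | pos = v , w , inj₁ (e , λ μv≡μw → pos≢neg (trans (sym μw) (trans (sym μv≡μw) μv)))
... | neg | neg = v , w , inj₂ (inj₂ (e , μv , μw))

module Corona {n₁ n₂} (G₁ : SignedGraph n₁) (G₂ : SignedGraph n₂)
              (μ₁ : Fin n₁ → Sign) (μ₂ : Fin n₂ → Sign) where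

  C : SAdj (n₁ + n₁ * n₂)
  C = corona (E G₁) μ₁ (E G₂) μ₂

  hub : Fin n₁ → Fin (n₁ + n₁ * n₂)
  hub i = i ↑ˡ (n₁ * n₂)

  copy : Fin n₁ → Fin n₂ → Fin (n₁ + n₁ * n₂)
  copy i v = n₁ ↑ʳ combine i v

  quotRem-combine : ∀ i v → quotRem {n₁} n₂ (combine i v) ≡ (v , i)
  quotRem-combine i v = cong swap (remQuot-combine i v)

  hub-copy : ∀ i v → C (hub i) (copy i v) ≡ just (μ₁ i · μ₂ v)
  hub-copy i v rewrite splitAt-↑ˡ n₁ i (n₁ * n₂) | splitAt-↑ʳ n₁ (n₁ * n₂) (combine i v)
                     | quotRem-combine i v | dec-true (i ≟ i) refl = refl

  copy-hub : ∀ i v → C (copy i v) (hub i) ≡ just (μ₁ i · μ₂ v)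
  copy-hub i v rewrite splitAt-↑ˡ n₁ i (n₁ * n₂) | splitAt-↑ʳ n₁ (n₁ * n₂) (combine i v)
                     | quotRem-combine i v | dec-true (i ≟ i) refl = refl

  copy-copy : ∀ i v w → C (copy i v) (copy i w) ≡ E G₂ v w
  copy-copy i v w rewrite splitAt-↑ʳ n₁ (n₁ * n₂) (combine i v) | splitAt-↑ʳ n₁ (n₁ * n₂) (combine i w)
                        | quotRem-combine i v | quotRem-combine i w | dec-true (i ≟ i) refl = refl

  hub≢copy : ∀ i j v → hub i ≢ copy j v
  hub≢copy i j v eq with trans (sym (splitAt-↑ˡ n₁ i (n₁ * n₂)))
                               (trans (cong (splitAt n₁) eq) (splitAt-↑ʳ n₁ (n₁ * n₂) (combine j v)))
  ... | ()

  copy-injective : ∀ i v w → copy i v ≡ copy i w → v ≡ w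
  copy-injective i v w eq = combine-injectiveʳ i v i w (↑ʳ-injective n₁ _ _ eq)

  -- Both read
  -- the node the way corona does, so that they compute along its cases.
  projection : Fin (n₁ + n₁ * n₂) → Fin n₁
  projection x = either (λ i → i) (λ q → proj₁ (remQuot {n₁} n₂ q)) (splitAt n₁ x)

  τ : Fin (n₁ + n₁ * n₂) → Sign
  τ x = either (λ _ → pos) (λ q → μ₁ (proj₁ (remQuot {n₁} n₂ q)) · μ₂ (proj₂ (remQuot {n₁} n₂ q)))
               (splitAt n₁ x)

  -- Without frustrated edges in G₂ the projection is a switching map: edges
  -- of G₁ keep their sign, the other edges stay inside one u_i and copy.
  projection-switching : Consistent (E G₂) μ₂ → SwitchingMap C G₁ projection τ
  projection-switching consistent x y s e with splitAt n₁ x | splitAt n₁ y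
  ... | inj₁ a | inj₁ b = inj₁ (s , e) , sym (trans (·-identityʳ _) (cong signOf e))
  ... | inj₁ a | inj₂ q with quotRem {n₁} n₂ q
  ...   | v , i with a ≟ i
  ...     | no _ = contradiction e λ ()
  ...     | yes refl rewrite E-loop G₁ a = inj₂ refl , sym (just-injective e)
  projection-switching consistent x y s e | inj₂ p | inj₁ a with quotRem {n₁} n₂ p
  ...   | v , i with a ≟ i
  ...     | no _ = contradiction e λ ()
  ...     | yes refl rewrite E-loop G₁ a = inj₂ refl , trans (sym (just-injective e)) (sym (·-identityʳ _))
  projection-switching consistent x y s e | inj₂ p | inj₂ q with quotRem {n₁} n₂ p | quotRem {n₁} n₂ q
  ...   | v , i | w , j with i ≟ j
  ...     | no _ = contradiction e λ ()
  ...     | yes refl rewrite E-loop G₁ i =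
    inj₂ refl , trans (consistent v w s e) (sym (·-switch (μ₁ i) (μ₂ v) (μ₂ w)))

  consistent⇒balanced : Consistent (E G₂) μ₂ → Balanced (E G₁) → Balanced C
  consistent⇒balanced consistent =
    Switching.reflects-balance C G₁ projection τ (projection-switching consistent)

  -- the triangle u_i, (i , v), (i , w) has the sign of the edge v w
  -- multiplied by μ₂(v) μ₂(w): the hub edges both contribute μ₁(u_i)
  triangle-sign : ∀ i v w → cycleSign C (hub i ∷ copy i v ∷ copy i w ∷ [])
                            ≡ (μ₂ v · μ₂ w) · signOf (E G₂ v w)
  triangle-sign i v w rewrite hub-copy i v | copy-copy i v w | copy-hub i w = begin
    a · (s · (b · pos))     ≡⟨ cong (λ u → a · (s · u)) (·-identityʳ b) ⟩
    a · (s · b)             ≡⟨ cong (a ·_) (·-comm s b) ⟩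
    a · (b · s)             ≡⟨ sym (·-assoc a b s) ⟩
    (a · b) · s             ≡⟨ cong (_· s) (·-switch (μ₁ i) (μ₂ v) (μ₂ w)) ⟩
    (μ₂ v · μ₂ w) · s       ∎
    where
      a = μ₁ i · μ₂ v
      b = μ₁ i · μ₂ w
      s = signOf (E G₂ v w)

  frustrated⇒unbalanced : Fin n₁ → Frustrated (E G₂) μ₂ → ¬ Balanced C
  frustrated⇒unbalanced i (v , w , e) balanced = pos≢neg (begin
    pos                                            ≡⟨ sym (balanced triangle is-cycle) ⟩
    cycleSign C triangle                           ≡⟨ triangle-sign i v w ⟩
    (μ₂ v · μ₂ w) · signOf (E G₂ v w)              ≡⟨ cong (λ u → (μ₂ v · μ₂ w) · signOf u) e ⟩
    (μ₂ v · μ₂ w) · (neg · (μ₂ v · μ₂ w))          ≡⟨ cong ((μ₂ v · μ₂ w) ·_) (·-comm neg (μ₂ v · μ₂ w)) ⟩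
    (μ₂ v · μ₂ w) · ((μ₂ v · μ₂ w) · neg)          ≡⟨ ·-cancelˡ (μ₂ v · μ₂ w) neg ⟩
    neg                                            ∎)
    where
      triangle : List (Fin (n₁ + n₁ * n₂))
      triangle = hub i ∷ copy i v ∷ copy i w ∷ []

      v≢w : v ≢ w
      v≢w refl = contradiction (trans (sym e) (E-loop G₂ v)) λ ()

      is-cycle : IsCycle C triangle
      is-cycle = s≤s (s≤s (s≤s z≤n))
               , ( (hub≢copy i i v ∷ hub≢copy i i w ∷ [])
                 ∷ ((λ eq → v≢w (copy-injective i v w eq)) ∷ [])
                 ∷ [] ∷ [])
               , ( (_ , hub-copy i v) ∷ (_ , trans (copy-copy i v w) e) ∷ (_ , copy-hub i w) ∷ [])

theorem1 : ∀ {n₁ n₂} (G₁ : SignedGraph n₁) (G₂ : SignedGraph n₂)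
           (m₁ m₂ : MarkingScheme) →
           1 ≤ n₁ → 1 ≤ n₂ →
           Balanced (E G₁) → Balanced (E G₂) →
           (¬ Balanced (corona (E G₁) (marking m₁ (E G₁)) (E G₂) (marking m₂ (E G₂)))
             → HasSpecialEdge (E G₂) (marking m₂ (E G₂)))
           × (HasSpecialEdge (E G₂) (marking m₂ (E G₂))
             → ¬ Balanced (corona (E G₁) (marking m₁ (E G₁)) (E G₂) (marking m₂ (E G₂))))
theorem1 G₁ G₂ m₁ m₂ 0<n₁ _ balanced₁ _ = unbalanced⇒special , special⇒unbalanced
  where
    μ₂ = marking m₂ (E G₂)
    open Corona G₁ G₂ (marking m₁ (E G₁)) μ₂

    unbalanced⇒special : ¬ Balanced C → HasSpecialEdge (E G₂) μ₂
    unbalanced⇒special unbalanced with frustrated-or-consistent (E G₂) μ₂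
    ... | inj₁ frustrated = frustrated⇒special (E G₂) μ₂ frustrated
    ... | inj₂ consistent = ⊥-elim (unbalanced (consistent⇒balanced consistent balanced₁))

    special⇒unbalanced : HasSpecialEdge (E G₂) μ₂ → ¬ Balanced C
    special⇒unbalanced special =
      frustrated⇒unbalanced (fromℕ< 0<n₁) (special⇒frustrated (E G₂) μ₂ special)
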